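{- The notion of reduction $\mathit{ass}$ is weakly Church–Rosser: for all computations $M,N,L$, if $M\longrightarrow_{\mathit{ass}}N$ and $M\longrightarrow_{\mathit{ass}}L$, then there is a computation $M'$ with $N\longrightarrow^*_{\mathit{ass}}M'$ and $L\longrightarrow^*_{\mathit{ass}}M'$.
   Context: Syntax of $\lambda_c^u$: values $V ::= x\mid \lambda x.M$, computations $M ::= \mathit{unit}\,V\mid M\star V$ (up to renaming of bound variables). $\mathit{ass}$ is the set of pairs $((L\star\lambda x.M)\star\lambda y.N,\ L\star\lambda x.(M\star\lambda y.N))$ with $x\notin FV(N)$. $\longrightarrow_{\mathit{ass}}$ is its compatible closure: if $(M,M')\in\mathit{ass}$ then $\mathcal C[M]\longrightarrow_{\mathit{ass}}\mathcal C[M']$ for every computation context, where value contexts are $\mathcal V ::= [\cdot]\mid\lambda x.\mathcal C$ and computation contexts $\mathcal C ::= [\cdot]\mid\mathit{unit}\,\mathcal V\mid\mathcal C\star V\mid M\star\mathcal V$. $\longrightarrow^*_{\mathit{ass}}$ is its reflexive–transitive closure. -}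

module Defs where

open import Data.Nat using (ℕ; zero; suc)
open import Relation.Binary.Construct.Closure.ReflexiveTransitive using (Star)

-- Syntax of λc^u, up to α-equivalence, via de Bruijn indices.
-- A variable is a natural number index; lam binds index 0.
mutual
  data Val : Set where
    var : ℕ → Val
    lam : Comp → Val

  data Comp : Set where
    unit : Val → Comp
    _⋆_  : Comp → Val → Comp

infixl 5 _⋆_

Ren : Set
Ren = ℕ → ℕ

liftRen : Ren → Ren
liftRen ρ zero    = zero
liftRen ρ (suc n) = suc (ρ n)

mutual
  renV : Ren → Val → Val
  renV ρ (var n) = var (ρ n)
  renV ρ (lam M) = lam (renC (liftRen ρ) M)

  renC : Ren → Comp → Comp
  renC ρ (unit V) = unit (renV ρ V)
  renC ρ (M ⋆ V)  = renC ρ M ⋆ renV ρ V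

-- Weakening that inserts a fresh variable x just below the innermost binder y:
-- in  (L ⋆ λx.M) ⋆ λy.N  the body N sees y as index 0; in
-- L ⋆ λx.(M ⋆ λy.N)  it sees y as 0 and x as 1, and x ∉ FV(N).
weakenUnder1 : Comp → Comp
weakenUnder1 = renC (liftRen suc)

data Ass : Comp → Comp → Set where
  ass : ∀ L M N →
        Ass ((L ⋆ lam M) ⋆ lam N) (L ⋆ lam (M ⋆ lam (weakenUnder1 N)))

mutual
  data _⟶V_ : Val → Val → Set where
    ξ-lam : ∀ {M M'} → M ⟶ M' → lam M ⟶V lam M'

  data _⟶_ : Comp → Comp → Set where
    root   : ∀ {M M'} → Ass M M' → M ⟶ M'
    ξ-unit : ∀ {V V'} → V ⟶V V' → unit V ⟶ unit V'
    ξ-⋆ˡ   : ∀ {M M' V} → M ⟶ M' → (M ⋆ V) ⟶ (M' ⋆ V)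
    ξ-⋆ʳ   : ∀ {M V V'} → V ⟶V V' → (M ⋆ V) ⟶ (M ⋆ V')

infix 4 _⟶_ _⟶V_ _⟶*_

_⟶*_ : Comp → Comp → Set
_⟶*_ = Star _⟶_

-- Weak Church–Rosser by critical pairs. The only overlap of ass with itself
-- is at ((L ⋆ λx.M) ⋆ λy.N) ⋆ λz.P, which is closed by Mac Lane's pentagon:
-- one ass-step on one side, two on the other. Every other pair of steps is
-- either disjoint or nested inside a redex, and commutes with it in one step
-- each; when the inner step happens in N, the redex weakens N, so we need
-- that reduction is stable under renaming.
module Submission where

open import Defs
open import Data.Product using (Σ; _×_; _,_)
open import Data.Nat using (zero; suc)
open import Function using (_∘_)
open import Relation.Binary.PropositionalEquality using (_≡_; refl; sym; trans; cong; cong₂)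
open import Relation.Binary.Construct.Closure.ReflexiveTransitive using (ε; _◅_; gmap)

liftRen-∘ : ∀ {ρ σ τ : Ren} → (∀ n → ρ (σ n) ≡ τ n) →
            ∀ n → liftRen ρ (liftRen σ n) ≡ liftRen τ n
liftRen-∘ h zero    = refl
liftRen-∘ h (suc n) = cong suc (h n)

mutual
  renV-∘ : ∀ {ρ σ τ : Ren} → (∀ n → ρ (σ n) ≡ τ n) → ∀ V → renV ρ (renV σ V) ≡ renV τ V
  renV-∘ h (var n) = cong var (h n)
  renV-∘ h (lam M) = cong lam (renC-∘ (liftRen-∘ h) M)

  renC-∘ : ∀ {ρ σ τ : Ren} → (∀ n → ρ (σ n) ≡ τ n) → ∀ M → renC ρ (renC σ M) ≡ renC τ M
  renC-∘ h (unit V) = cong unit (renV-∘ h V)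
  renC-∘ h (M ⋆ V)  = cong₂ _⋆_ (renC-∘ h M) (renV-∘ h V)

renC-weakenUnder1 : ∀ ρ N →
  renC (liftRen (liftRen ρ)) (weakenUnder1 N) ≡ weakenUnder1 (renC (liftRen ρ) N)
renC-weakenUnder1 ρ N = trans (renC-∘ {τ = τ} (λ _ → refl) N) (sym (renC-∘ commute N))
  where
  τ : Ren
  τ = liftRen (liftRen ρ) ∘ liftRen suc

  commute : ∀ n → liftRen suc (liftRen ρ n) ≡ τ n
  commute zero    = refl
  commute (suc n) = refl

ass-step : ∀ L M N {N'} → N' ≡ weakenUnder1 N →
           (L ⋆ lam M) ⋆ lam N ⟶ L ⋆ lam (M ⋆ lam N')
ass-step L M N refl = root (ass L M N)

mutual
  renV-⟶ : ∀ ρ {V V'} → V ⟶V V' → renV ρ V ⟶V renV ρ V'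
  renV-⟶ ρ (ξ-lam s) = ξ-lam (renC-⟶ (liftRen ρ) s)

  renC-⟶ : ∀ ρ {M M'} → M ⟶ M' → renC ρ M ⟶ renC ρ M'
  renC-⟶ ρ (root (ass L M N)) =
    ass-step (renC ρ L) (renC (liftRen ρ) M) (renC (liftRen ρ) N) (renC-weakenUnder1 ρ N)
  renC-⟶ ρ (ξ-unit s) = ξ-unit (renV-⟶ ρ s)
  renC-⟶ ρ (ξ-⋆ˡ s)   = ξ-⋆ˡ (renC-⟶ ρ s)
  renC-⟶ ρ (ξ-⋆ʳ s)   = ξ-⋆ʳ (renV-⟶ ρ s)

Joinable : Comp → Comp → Set
Joinable N L = Σ Comp (λ M' → (N ⟶* M') × (L ⟶* M'))

Joinable-sym : ∀ {N L} → Joinable N L → Joinable L N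
Joinable-sym (M' , N⟶*M' , L⟶*M') = M' , L⟶*M' , N⟶*M'

Joinable-cong : (f : Comp → Comp) → (∀ {M M'} → M ⟶ M' → f M ⟶ f M') →
                ∀ {N L} → Joinable N L → Joinable (f N) (f L)
Joinable-cong f f-⟶ (M' , N⟶*M' , L⟶*M') = f M' , gmap f f-⟶ N⟶*M' , gmap f f-⟶ L⟶*M'

joinable-in-one-step : ∀ {N L P} → N ⟶ P → L ⟶ P → Joinable N L
joinable-in-one-step N⟶P L⟶P = _ , N⟶P ◅ ε , L⟶P ◅ ε

ass-pentagon : ∀ L M N P →
  Joinable ((L ⋆ lam M) ⋆ lam (N ⋆ lam (weakenUnder1 P)))
           ((L ⋆ lam (M ⋆ lam (weakenUnder1 N))) ⋆ lam P)
ass-pentagon L M N P =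
  _ , root (ass L M (N ⋆ lam (weakenUnder1 P))) ◅ ε
    , root (ass L (M ⋆ lam (weakenUnder1 N)) P)
    ◅ ξ-⋆ʳ (ξ-lam (ass-step M (weakenUnder1 N) (weakenUnder1 P)
                            (renC-weakenUnder1 suc P)))
    ◅ ε

Ass-locally-confluent : ∀ {M N L} → Ass M N → M ⟶ L → Joinable N L
Ass-locally-confluent (ass L M N) (root (ass .L .M .N)) = _ , ε , ε
Ass-locally-confluent (ass _ M N) (ξ-⋆ˡ (root (ass L₀ M₀ .M))) =
  ass-pentagon L₀ M₀ M N
Ass-locally-confluent (ass _ M N) (ξ-⋆ˡ (ξ-⋆ˡ t)) =
  joinable-in-one-step (ξ-⋆ˡ t) (root (ass _ M N))
Ass-locally-confluent (ass L _ N) (ξ-⋆ˡ (ξ-⋆ʳ (ξ-lam t))) =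
  joinable-in-one-step (ξ-⋆ʳ (ξ-lam (ξ-⋆ˡ t))) (root (ass L _ N))
Ass-locally-confluent (ass L M N) (ξ-⋆ʳ (ξ-lam t)) =
  joinable-in-one-step
    (ξ-⋆ʳ (ξ-lam (ξ-⋆ʳ (ξ-lam (renC-⟶ (liftRen suc) t))))) (root (ass L M _))

⟶-locally-confluent : ∀ {M N L} → M ⟶ N → M ⟶ L → Joinable N L
⟶-locally-confluent (root a) t = Ass-locally-confluent a t
⟶-locally-confluent s (root a) = Joinable-sym (Ass-locally-confluent a s)
⟶-locally-confluent (ξ-unit (ξ-lam s)) (ξ-unit (ξ-lam t)) =
  Joinable-cong (unit ∘ lam) (ξ-unit ∘ ξ-lam) (⟶-locally-confluent s t)
⟶-locally-confluent (ξ-⋆ˡ {V = V} s) (ξ-⋆ˡ t) =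
  Joinable-cong (_⋆ V) ξ-⋆ˡ (⟶-locally-confluent s t)
⟶-locally-confluent (ξ-⋆ˡ s) (ξ-⋆ʳ t) = joinable-in-one-step (ξ-⋆ʳ t) (ξ-⋆ˡ s)
⟶-locally-confluent (ξ-⋆ʳ s) (ξ-⋆ˡ t) = joinable-in-one-step (ξ-⋆ˡ t) (ξ-⋆ʳ s)
⟶-locally-confluent (ξ-⋆ʳ {M = M} (ξ-lam s)) (ξ-⋆ʳ (ξ-lam t)) =
  Joinable-cong (λ X → M ⋆ lam X) (ξ-⋆ʳ ∘ ξ-lam) (⟶-locally-confluent s t)

mainTheorem15 : (M N L : Comp) → M ⟶ N → M ⟶ L → Σ Comp (λ M' → (N ⟶* M') × (L ⟶* M'))
mainTheorem15 M N L = ⟶-locally-confluent
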